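{- Expressive disjunctive sequent calculi, as objects, with consequence relations as morphisms, form a category $\mathbf{EDSC}$, where the composite of consequence relations $\Theta:(\mathcal{L}(P),\vdash_P)\to(\mathcal{L}(Q),\vdash_Q)$ and $\Theta':(\mathcal{L}(Q),\vdash_Q)\to(\mathcal{L}(R),\vdash_R)$ is the relation $\Theta'\circ\Theta\subseteq\mathcal{IC}(P)\times\mathcal{L}(R)$ given by $(\mu,\varphi)\in\Theta'\circ\Theta$ iff there is $\nu\in\mathcal{IC}(Q)$ with $(\mu,\nu)\in\Theta$ and $(\nu,\varphi)\in\Theta'$, and the identity on $(\mathcal{L}(P),\vdash_P)$ is $\mathrm{id}_P\subseteq\mathcal{IC}(P)\times\mathcal{L}(P)$ given by $(\mu,\varphi)\in\mathrm{id}_P$ iff $\varphi\in\{\mu\}[\vdash_P]$. (In particular these composites and identities are consequence relations.)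
   Context: Disjunctive sequent calculi: a disjunctive basis is $(P,\mathcal{A}_P)$ with $P$ a set of atomic formulae and $\mathcal{A}_P$ a set of sequents $p_1,\dots,p_n\vdash\mathrm{F}$, $p_i\in P$. Formulae $\mathcal{L}(P)$ and valid sequents $\Gamma\vdash\varphi$ ($\Gamma$ finite) are generated by simultaneous transfinite induction: atoms, $\mathrm{T}$, $\mathrm{F}$ are formulae; $\phi\wedge\psi$; $\dot{\bigvee}_{i\in I}\phi_i$ whenever $\phi_i,\phi_j\vdash\mathrm{F}$ valid for all $i\ne j$. Valid sequents: members of $\mathcal{A}_P$; $\phi\vdash\phi$; $\Gamma\vdash\psi\Rightarrow\Gamma,\phi\vdash\psi$; $\Gamma\vdash\phi,\ \Delta,\phi\vdash\psi\Rightarrow\Gamma,\Delta\vdash\psi$; $\mathrm{F}\vdash\phi$; $\vdash\mathrm{T}$; $\Gamma,\phi,\psi\vdash\theta\Rightarrow\Gamma,\phi\wedge\psi\vdash\theta$; $\Gamma\vdash\phi,\ \Delta\vdash\psi\Rightarrow\Gamma,\Delta\vdash\phi\wedge\psi$; for families with $\phi_i,\phi_j\vdash\mathrm{F}$ ($i\neq j$): ($\Gamma,\phi_i\vdash\theta$ for all $i$) $\Rightarrow\Gamma,\dot{\bigvee}_i\phi_i\vdash\theta$, and $\Gamma\vdash\phi_{i_0}\Rightarrow\Gamma\vdash\dot{\bigvee}_i\phi_i$. $X[\vdash]=\{\varphi:\Gamma\vdash\varphi\text{ valid for some finite }\Gamma\subseteq X\}$. Tautology: $\mathrm{T}\vdash\varphi$;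 contradiction: $\varphi\vdash\mathrm{F}$; satisfiable: neither. Conjunction: satisfiable formula built from atoms by $\wedge$ only. Flat formula: satisfiable $\dot{\bigvee}_i\mu_i$, $\mu_i$ conjunctions, $\mu_i,\mu_j\vdash\mathrm{F}$ for $i\ne j$. Irreducible conjunction $\mu$: whenever $\mu\vdash\dot{\bigvee}_i\phi_i$ valid (with $\phi_i,\phi_j\vdash\mathrm{F}$ for $i\ne j$), $\mu\vdash\phi_{i_0}$ valid for some $i_0$; $\mathcal{IC}(P)$ is their set. Irreducible flat formula: all $\mu_i$ irreducible. Expressive: every satisfiable $\psi$ has an irreducible flat formula $\dot{\bigvee}_i\mu_i$ with $\psi\vdash\dot{\bigvee}_i\mu_i$ and all $\mu_i\vdash\psi$ valid. A consequence relation from $(\mathcal{L}(P),\vdash_P)$ to $(\mathcal{L}(Q),\vdash_Q)$ (both expressive) is $\Theta\subseteq\mathcal{IC}(P)\times\mathcal{L}(Q)$ with (R1) $(\nu,\psi)\in\Theta$, $\mu\vdash_P\nu$ valid $\Rightarrow(\mu,\psi)\in\Theta$; (R2) $(\mu,\varphi)\in\Theta$, $\varphi\vdash_Q\psi$ valid $\Rightarrow(\mu,\psi)\in\Theta$; (R3) $(\mu,\psi)\in\Theta\Rightarrow$ some $\nu\in\mathcal{IC}(Q)$ has $(\mu,\nu)\in\Theta$ and $\nu\vdash_Q\psi$ valid. -}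

module Defs where

open import Level using (Level)
open import Data.List using (List; []; _∷_; _++_; map)
open import Data.List.Membership.Propositional using (_∈_)
open import Data.List.Relation.Unary.All using (All)
open import Data.Product using (Σ; _×_; _,_; ∃; ∃-syntax)
open import Relation.Binary.PropositionalEquality using (_≡_)
open import Relation.Nullary using (¬_)

-- Disjunctive basis (P , A_P): a set of atoms and a set of sequents
-- p₁ , … , pₙ ⊢ F (given as a predicate on the list p₁ … pₙ).

record Basis : Set₁ where
  field
    Atom  : Set
    Axiom : List Atom → Set
open Basis public

-- Contexts Γ are finite lists, considered up to having the same
-- members (structural rules exch/contr below), i.e. as finite sets.  "Γ , φ" is φ ∷ Γ.

module _ (B : Basis) where
  infixr 6 _∧_
  infix 4 _⊢_

  data Formula : Set₁
  data _⊢_ : List Formula → Formula → Set₁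

  data Formula where
    atom : Atom B → Formula
    T F  : Formula
    _∧_  : Formula → Formula → Formula
    ⋁    : (I : Set) (φ : I → Formula) →
           (∀ i j → ¬ i ≡ j → (φ i ∷ φ j ∷ []) ⊢ F) → Formula

  data _⊢_ where
    axiom : ∀ {ps} → Axiom B ps → map atom ps ⊢ F
    idt   : ∀ {φ} → (φ ∷ []) ⊢ φ
    exch  : ∀ Γ {Δ φ ψ θ} → (Γ ++ φ ∷ ψ ∷ Δ) ⊢ θ → (Γ ++ ψ ∷ φ ∷ Δ) ⊢ θ
    contr : ∀ {Γ φ θ} → (φ ∷ φ ∷ Γ) ⊢ θ → (φ ∷ Γ) ⊢ θ
    weak  : ∀ {Γ φ ψ} → Γ ⊢ ψ → (φ ∷ Γ) ⊢ ψ
    cut   : ∀ {Γ Δ φ ψ} → Γ ⊢ φ → (φ ∷ Δ) ⊢ ψ → (Γ ++ Δ) ⊢ ψ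
    F-L   : ∀ {φ} → (F ∷ []) ⊢ φ
    T-R   : [] ⊢ T
    ∧-L   : ∀ {Γ φ ψ θ} → (φ ∷ ψ ∷ Γ) ⊢ θ → ((φ ∧ ψ) ∷ Γ) ⊢ θ
    ∧-R   : ∀ {Γ Δ φ ψ} → Γ ⊢ φ → Δ ⊢ ψ → (Γ ++ Δ) ⊢ (φ ∧ ψ)
    ⋁-L   : ∀ {Γ θ I φ d} → (∀ i → (φ i ∷ Γ) ⊢ θ) → (⋁ I φ d ∷ Γ) ⊢ θ
    ⋁-R   : ∀ {Γ I φ d} (i : I) → Γ ⊢ φ i → Γ ⊢ ⋁ I φ d

open Formula public
open _⊢_ public

module _ {B : Basis} where

  -- X[⊢] for X = {μ}: φ ∈ {μ}[⊢] iff Γ ⊢ φ for some finite Γ ⊆ {μ}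
  InClosureOf : Formula B → Formula B → Set₁
  InClosureOf μ φ = Σ (List (Formula B)) λ Γ → All (_≡ μ) Γ × _⊢_ B Γ φ

  Tautology Contradiction Satisfiable : Formula B → Set₁
  Tautology φ     = _⊢_ B (T ∷ []) φ
  Contradiction φ = _⊢_ B (φ ∷ []) F
  Satisfiable φ   = ¬ Tautology φ × ¬ Contradiction φ

  data ConjShape : Formula B → Set₁ where
    atomS : ∀ p → ConjShape (atom p)
    ∧S    : ∀ {φ ψ} → ConjShape φ → ConjShape ψ → ConjShape (φ ∧ ψ)

  Conjunction : Formula B → Set₁
  Conjunction μ = ConjShape μ × Satisfiable μ

  IrredConj : Formula B → Set₁
  IrredConj μ = Conjunction μ ×
    (∀ (I : Set) (φ : I → Formula B) d →
       _⊢_ B (μ ∷ []) (⋁ I φ d) → ∃[ i ] _⊢_ B (μ ∷ []) (φ i))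

  -- flat formula ⋁ I μ d (the disjointness d is part of the formula)
  Flat : (I : Set) (μ : I → Formula B) → _ → Set₁
  Flat I μ d = Satisfiable (⋁ I μ d) × (∀ i → Conjunction (μ i))

  IrredFlat : (I : Set) (μ : I → Formula B) → _ → Set₁
  IrredFlat I μ d = Flat I μ d × (∀ i → IrredConj (μ i))

Expressive : Basis → Set₁
Expressive B = ∀ (ψ : Formula B) → Satisfiable ψ →
  Σ Set λ I → Σ (I → Formula B) λ μ → Σ _ λ d →
    IrredFlat I μ d × _⊢_ B (ψ ∷ []) (⋁ I μ d) × (∀ i → _⊢_ B (μ i ∷ []) ψ)

HRel : Basis → Basis → Set₂
HRel P Q = Formula P → Formula Q → Set₁

record IsConsequence {P Q : Basis} (Θ : HRel P Q) : Set₁ where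
  field
    support : ∀ {μ ψ} → Θ μ ψ → IrredConj μ           -- Θ ⊆ IC(P) × L(Q)
    R1 : ∀ {μ ν ψ} → IrredConj μ → Θ ν ψ → _⊢_ P (μ ∷ []) ν → Θ μ ψ
    R2 : ∀ {μ φ ψ} → Θ μ φ → _⊢_ Q (φ ∷ []) ψ → Θ μ ψ
    R3 : ∀ {μ ψ} → Θ μ ψ →
         ∃[ ν ] (IrredConj ν × Θ μ ν × _⊢_ Q (ν ∷ []) ψ)

_∘ᶜ_ : ∀ {P Q R} → HRel Q R → HRel P Q → HRel P R
(Θ' ∘ᶜ Θ) μ φ = ∃[ ν ] (IrredConj ν × Θ μ ν × Θ' ν φ)

idᶜ : (P : Basis) → HRel P P
idᶜ P μ φ = IrredConj μ × InClosureOf μ φ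

_≐_ : ∀ {P Q} → HRel P Q → HRel P Q → Set₁
Θ ≐ Θ' = ∀ μ φ → (Θ μ φ → Θ' μ φ) × (Θ' μ φ → Θ μ φ)

-- R1 and R2 pass through the middle witness of a
-- composite, R3 is inherited from the outer relation, and idᶜ satisfies them by cut,
-- since a closure {μ}[⊢] member is just a sequent μ ⊢ φ after contracting copies of μ.
-- The right unit law is R1 and the left one is R2 together with R3; associativity
-- only reassociates witnesses.

module Submission where

open import Defs
open import Data.Product using (_×_; _,_; proj₁)
open import Data.List using ([]; _∷_)
open import Data.List.Relation.Unary.All using (All; []; _∷_)
open import Relation.Binary.PropositionalEquality using (_≡_; refl)

module _ {B : Basis} where

  ⊢-contractCopies : ∀ {ν : Formula B} {Γ ψ} →
                     All (_≡ ν) Γ → _⊢_ B Γ ψ → _⊢_ B (ν ∷ []) ψ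
  ⊢-contractCopies []                    Γ⊢ψ = weak Γ⊢ψ
  ⊢-contractCopies (refl ∷ [])           Γ⊢ψ = Γ⊢ψ
  ⊢-contractCopies (refl ∷ ν≡@(refl ∷ _)) Γ⊢ψ = ⊢-contractCopies ν≡ (contr Γ⊢ψ)

  closure⇒⊢ : ∀ {μ φ : Formula B} → InClosureOf μ φ → _⊢_ B (μ ∷ []) φ
  closure⇒⊢ (_ , Γ≡μ , Γ⊢φ) = ⊢-contractCopies Γ≡μ Γ⊢φ

  ⊢⇒closure : ∀ {μ φ : Formula B} → _⊢_ B (μ ∷ []) φ → InClosureOf μ φ
  ⊢⇒closure μ⊢φ = _ ∷ [] , refl ∷ [] , μ⊢φ

  idᶜ-refl : ∀ {μ : Formula B} → IrredConj μ → idᶜ B μ μ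
  idᶜ-refl irr = irr , ⊢⇒closure idt

∘ᶜ-isConsequence : ∀ {P Q R} {Θ : HRel P Q} {Θ' : HRel Q R} →
                   IsConsequence Θ → IsConsequence Θ' → IsConsequence (Θ' ∘ᶜ Θ)
∘ᶜ-isConsequence c c' = record
  { support = λ { (_ , _ , μΘν , _) → C.support μΘν }
  ; R1 = λ { irr (ν , irrν , μ'Θν , νΘ'φ) μ⊢μ' → ν , irrν , C.R1 irr μ'Θν μ⊢μ' , νΘ'φ }
  ; R2 = λ { (ν , irrν , μΘν , νΘ'φ) φ⊢ψ → ν , irrν , μΘν , C'.R2 νΘ'φ φ⊢ψ }
  ; R3 = λ { (ν , irrν , μΘν , νΘ'ψ) →
             let (ρ , irrρ , νΘ'ρ , ρ⊢ψ) = C'.R3 νΘ'ψ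
             in ρ , irrρ , (ν , irrν , μΘν , νΘ'ρ) , ρ⊢ψ }
  }
  where module C = IsConsequence c
        module C' = IsConsequence c'

idᶜ-isConsequence : ∀ P → IsConsequence (idᶜ P)
idᶜ-isConsequence P = record
  { support = proj₁
  ; R1 = λ { irr (_ , νcl) μ⊢ν → irr , ⊢⇒closure (cut μ⊢ν (closure⇒⊢ νcl)) }
  ; R2 = λ { (irr , φcl) φ⊢ψ → irr , ⊢⇒closure (cut (closure⇒⊢ φcl) φ⊢ψ) }
  ; R3 = λ { {μ} (irr , ψcl) → μ , irr , idᶜ-refl irr , closure⇒⊢ ψcl }
  }

module _ {P Q : Basis} {Θ : HRel P Q} (c : IsConsequence Θ) where
  open IsConsequence c

  ∘ᶜ-identityʳ : (Θ ∘ᶜ idᶜ P) ≐ Θ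
  ∘ᶜ-identityʳ μ φ =
    (λ { (_ , _ , (irr , νcl) , νΘφ) → R1 irr νΘφ (closure⇒⊢ νcl) }) ,
    (λ μΘφ → μ , support μΘφ , idᶜ-refl (support μΘφ) , μΘφ)

  ∘ᶜ-identityˡ : (idᶜ Q ∘ᶜ Θ) ≐ Θ
  ∘ᶜ-identityˡ μ φ =
    (λ { (_ , _ , μΘν , (_ , φcl)) → R2 μΘν (closure⇒⊢ φcl) }) ,
    (λ μΘφ → let (ν , irrν , μΘν , ν⊢φ) = R3 μΘφ
             in ν , irrν , μΘν , (irrν , ⊢⇒closure ν⊢φ))

∘ᶜ-assoc : ∀ {P Q R S} (Θ : HRel P Q) (Θ' : HRel Q R) (Θ'' : HRel R S) →
           (Θ'' ∘ᶜ (Θ' ∘ᶜ Θ)) ≐ ((Θ'' ∘ᶜ Θ') ∘ᶜ Θ)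
∘ᶜ-assoc Θ Θ' Θ'' μ φ =
  (λ { (ρ , irrρ , (ν , irrν , μΘν , νΘ'ρ) , ρΘ''φ) →
       ν , irrν , μΘν , (ρ , irrρ , νΘ'ρ , ρΘ''φ) }) ,
  (λ { (ν , irrν , μΘν , (ρ , irrρ , νΘ'ρ , ρΘ''φ)) →
       ρ , irrρ , (ν , irrν , μΘν , νΘ'ρ) , ρΘ''φ })

proposition4p5 :
    -- composites of consequence relations are consequence relations
    (∀ (P Q R : Basis) → Expressive P → Expressive Q → Expressive R →
       (Θ : HRel P Q) (Θ' : HRel Q R) →
       IsConsequence Θ → IsConsequence Θ' → IsConsequence (Θ' ∘ᶜ Θ))
    -- identities are consequence relations
    × (∀ (P : Basis) → Expressive P → IsConsequence (idᶜ P))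
    -- unit laws
    × (∀ (P Q : Basis) → Expressive P → Expressive Q → (Θ : HRel P Q) →
         IsConsequence Θ → ((Θ ∘ᶜ idᶜ P) ≐ Θ) × ((idᶜ Q ∘ᶜ Θ) ≐ Θ))
    -- associativity
    × (∀ (P Q R S : Basis) → Expressive P → Expressive Q → Expressive R →
         Expressive S → (Θ : HRel P Q) (Θ' : HRel Q R) (Θ'' : HRel R S) →
         IsConsequence Θ → IsConsequence Θ' → IsConsequence Θ'' →
         ((Θ'' ∘ᶜ (Θ' ∘ᶜ Θ)) ≐ ((Θ'' ∘ᶜ Θ') ∘ᶜ Θ)))
proposition4p5 =
    (λ _ _ _ _ _ _ _ _ c c' → ∘ᶜ-isConsequence c c')
  , (λ P _ → idᶜ-isConsequence P)
  , (λ _ _ _ _ _ c → ∘ᶜ-identityʳ c , ∘ᶜ-identityˡ c)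
  , (λ _ _ _ _ _ _ _ _ Θ Θ' Θ'' _ _ _ → ∘ᶜ-assoc Θ Θ' Θ'')
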